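{- There is no algorithm that emulates the failure detector $\Sigma$ in the moving-source (MS) environment, even if the number of processes and their identities are known to all processes.
   Context: Message-passing system with a finite set of processes (here with known identities), any number of which may crash; correct processes are those that never crash. Communication proceeds in (unsynchronized) rounds: each process repeatedly broadcasts its round-$k$ message and then moves to round $k+1$, and every message is eventually delivered to every correct process. Process $p$ has a timely link in round $k$ if its round-$k$ message is received in round $k$ by every correct process. MS environment: in every round $k$ some process (possibly different for each $k$) has a timely link in round $k$. The quorum failure detector $\Sigma$ outputs, at each process and time, a list of process identities, subject to two properties. Intersection: any two output lists, possibly at different times and different processes, have a common element. Completeness: eventually, at every correct process, every process in the output list is correct. -}

module Defs where

open import Data.Nat using (ℕ; zero; suc; _<_; _≤_)
open import Data.Fin using (Fin; _≟_)
open import Data.List using (List)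
open import Data.List.Membership.Propositional using (_∈_)
open import Data.Maybe using (Maybe; just; nothing)
open import Data.Product using (Σ; ∃; _×_; _,_; proj₁; proj₂)
open import Data.Sum using (_⊎_)
open import Data.Bool using (if_then_else_)
open import Relation.Nullary using (¬_)
open import Data.Empty using (⊥)
open import Relation.Nullary.Decidable using (⌊_⌋)
open import Relation.Binary.PropositionalEquality using (_≡_)

-- Processes are Fin n (identities known).  Time is ℕ (one event per
-- time step).  A process's "round counter" is the number of broadcasts
-- it has performed.  Its round-k message (k : ℕ, rounds numbered from 0)
-- is its (k+1)-th broadcast, and a process is "in round k" from its
-- (k+1)-th broadcast until its (k+2)-th broadcast, i.e. while it has
-- performed exactly suc k broadcasts.

-- A deterministic distributed algorithm for n processes whose output
-- variable is a list of process identities (the emulated Σ output).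
record Algorithm (n : ℕ) : Set₁ where
  field
    State     : Set
    Msg       : Set
    init      : Fin n → State
    broadcast : State → Msg × State           -- round message + state after moving to the next round
    receive   : State → Fin n → ℕ → Msg → State  -- receive (sender, round, content)
    output    : State → List (Fin n)

data Event (n : ℕ) : Set where
  skip    : Event n
  bcast   : Fin n → Event n
  deliver : Fin n → Fin n → ℕ → Event n     -- deliver p q k : q's round-k message delivered to p

-- A run skeleton: crash times (nothing = correct; just c = takes no
-- step at times ≥ c) and a schedule.
record Run (n : ℕ) : Set where
  field
    crash : Fin n → Maybe ℕ
    sched : ℕ → Event n

module _ {n : ℕ} where

  update : {A : Set} → (Fin n → A) → Fin n → A → Fin n → A
  update f p v q = if ⌊ q ≟ p ⌋ then v else f q

  Correct : Run n → Fin n → Set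
  Correct R p = Run.crash R p ≡ nothing

  -- p has not crashed at time t (may take the step at time t)
  Alive : Run n → Fin n → ℕ → Set
  Alive R p t = Correct R p ⊎ Σ ℕ (λ c → Run.crash R p ≡ just c × t < c)

  Acts : Event n → Fin n → Set
  Acts skip p = ⊥
  Acts (bcast q) p = q ≡ p
  Acts (deliver r q k) p = r ≡ p

module Exec {n : ℕ} (A : Algorithm n) where
  open Algorithm A

  record Config : Set where
    field
      st   : Fin n → State
      rnd  : Fin n → ℕ
      sent : Fin n → ℕ → Maybe Msg

  initial : Config
  initial = record { st = init ; rnd = λ _ → 0 ; sent = λ _ _ → nothing }

  step : Config → Event n → Config
  step c skip = c
  step c (bcast p) =
    let open Config c
        ms = broadcast (st p)
    in record
      { st   = update st p (proj₂ ms)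
      ; rnd  = update rnd p (suc (rnd p))
      ; sent = update sent p (λ k → if ⌊ k Data.Nat.≟ rnd p ⌋ then just (proj₁ ms) else sent p k)
      }
  step c (deliver p q k) with Config.sent c q k
  ... | nothing = c
  ... | just m  = record c { st = update (Config.st c) p (receive (Config.st c p) q k m) }

  -- configuration after the events at times 0 … t-1
  conf : Run n → ℕ → Config
  conf R zero    = initial
  conf R (suc t) = step (conf R t) (Run.sched R t)

  stateAt : Run n → Fin n → ℕ → State
  stateAt R p t = Config.st (conf R t) p

  roundCount : Run n → Fin n → ℕ → ℕ
  roundCount R p t = Config.rnd (conf R t) p

  outAt : Run n → Fin n → ℕ → List (Fin n)
  outAt R p t = output (stateAt R p t)

  SentBefore : Run n → Fin n → ℕ → ℕ → Set
  SentBefore R q k t = k < roundCount R q t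

  record Admissible (R : Run n) : Set where
    open Run R
    field
      someCorrect  : ∃ λ p → Correct R p
      onlyAlive    : ∀ t p → Acts (sched t) p → Alive R p t
      deliverSent  : ∀ t p q k → sched t ≡ deliver p q k → SentBefore R q k t
      noDup        : ∀ t t' p q k → sched t ≡ deliver p q k → sched t' ≡ deliver p q k → t ≡ t'
      progress     : ∀ p → Correct R p → ∀ T → ∃ λ t → T ≤ t × sched t ≡ bcast p
      reliable     : ∀ q k t → SentBefore R q k t → ∀ p → Correct R p →
                     ∃ λ t' → sched t' ≡ deliver p q k
      -- MS: in every round k some process has a timely link in round k:
      -- its round-k message is received in round k by every correct process
      movingSource : ∀ k → ∃ λ q → ∀ p → Correct R p →
                     ∃ λ t → sched t ≡ deliver p q k × roundCount R p t ≡ suc k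

  record SigmaOutputs (R : Run n) : Set where
    field
      intersection : ∀ p p' t t' → ∃ λ x → x ∈ outAt R p t × x ∈ outAt R p' t'
      completeness : ∃ λ T → ∀ p → Correct R p → ∀ t → T ≤ t →
                     ∀ x → x ∈ outAt R p t → Correct R x

EmulatesΣ-MS : {n : ℕ} → Algorithm n → Set
EmulatesΣ-MS A = ∀ (R : Run _) → Exec.Admissible A R → Exec.SigmaOutputs A R

module Submission where

-- The proof is a partition argument with two admissible runs of a
-- hypothetical emulation on n ≥ 2 processes.
--   * soloRun: every process except p₀ crashes at time 0, and p₀ repeatedly
--     broadcasts and then receives its own message.  p₀ is its own timely
--     source in every round.  By completeness of Σ there is a time T after
--     which p₀ outputs only correct processes, i.e. only p₀ itself.
--   * handoverRun T: p₀ behaves exactly as in soloRun for T rounds (times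
--     0 … 2T-1) and then crashes; p₁ is the only correct process, receives
--     p₀'s T messages and then runs alone like p₀ did.  Up to time 2T the
--     two runs are indistinguishable to p₀, so p₀'s output at time 2T is
--     {p₀}-only, while by completeness p₁ eventually outputs only p₁.
-- These two outputs violate the intersection property in handoverRun T.

open import Defs
open import Data.Nat using (ℕ; zero; suc; _+_; _≤_; _<_; z≤n; s≤s)
open import Data.Nat.Properties
  using (≤-refl; ≤-reflexive; ≤-trans; <⇒≤; ≮⇒≥; _<?_; n≮0; m<n⇒m<1+n;
         m≤m+n; m≤n+m; m≤n⇒∃[o]m+o≡n; +-identityʳ; +-suc; +-comm; +-assoc)
open import Data.Fin using (Fin; _≟_) renaming (zero to fz; suc to fs)
open import Data.Maybe using (Maybe; just; nothing)
open import Data.Product using (∃; _×_; _,_; proj₂)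
open import Data.Sum using (_⊎_; inj₁; inj₂)
open import Data.Bool using (if_then_else_)
open import Data.Empty using (⊥-elim)
open import Data.List.Membership.Propositional using (_∈_)
open import Relation.Nullary using (¬_; yes; no)
open import Relation.Nullary.Decidable using (⌊_⌋)
open import Relation.Binary.PropositionalEquality
  using (_≡_; refl; sym; trans; cong; cong₂; subst)

module Schedules {n : ℕ} where

  broadcastBy : Event n → Fin n → ℕ
  broadcastBy skip            q = 0
  broadcastBy (bcast p)       q = if ⌊ q ≟ p ⌋ then 1 else 0
  broadcastBy (deliver _ _ _) q = 0

  broadcastBy-self : ∀ p → broadcastBy (bcast p) p ≡ 1
  broadcastBy-self p with p ≟ p
  ... | yes _   = refl
  ... | no p≢p = ⊥-elim (p≢p refl)

  broadcastBy-other : ∀ p q → ¬ q ≡ p → broadcastBy (bcast p) q ≡ 0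
  broadcastBy-other p q q≢p with q ≟ p
  ... | yes q≡p = ⊥-elim (q≢p q≡p)
  ... | no _    = refl

  broadcasts : (ℕ → Event n) → Fin n → ℕ → ℕ
  broadcasts s q zero    = 0
  broadcasts s q (suc t) = broadcasts s q t + broadcastBy (s t) q

  broadcasts-cong : ∀ s s' q t → (∀ i → i < t → s i ≡ s' i) →
                    broadcasts s q t ≡ broadcasts s' q t
  broadcasts-cong s s' q zero    same = refl
  broadcasts-cong s s' q (suc t) same =
    cong₂ _+_ (broadcasts-cong s s' q t (λ i i<t → same i (m<n⇒m<1+n i<t)))
              (cong (λ e → broadcastBy e q) (same t ≤-refl))

  broadcasts-mono : ∀ s q {t t'} → t ≤ t' → broadcasts s q t ≤ broadcasts s q t'
  broadcasts-mono s q {t} t≤t' with m≤n⇒∃[o]m+o≡n t≤t'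
  ... | d , refl = grow d
    where
    grow : ∀ d → broadcasts s q t ≤ broadcasts s q (t + d)
    grow zero    = ≤-reflexive (cong (broadcasts s q) (sym (+-identityʳ t)))
    grow (suc d) rewrite +-suc t d = ≤-trans (grow d) (m≤m+n _ _)

  Silent : (ℕ → Event n) → Fin n → Set
  Silent s q = ∀ i → broadcastBy (s i) q ≡ 0

  broadcasts-silent : ∀ s q → Silent s q → ∀ t → broadcasts s q t ≡ 0
  broadcasts-silent s q silent zero = refl
  broadcasts-silent s q silent (suc t)
    rewrite broadcasts-silent s q silent t | silent t = refl

  splice : ℕ → (ℕ → Event n) → (ℕ → Event n) → ℕ → Event n
  splice zero    g f t       = f t
  splice (suc k) g f zero    = g zero
  splice (suc k) g f (suc t) = splice k (λ i → g (suc i)) f t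

  splice-before : ∀ k g f t → t < k → splice k g f t ≡ g t
  splice-before (suc k) g f zero    _         = refl
  splice-before (suc k) g f (suc t) (s≤s t<k) = splice-before k (λ i → g (suc i)) f t t<k

  splice-after : ∀ k g f u → splice k g f (k + u) ≡ f u
  splice-after zero    g f u = refl
  splice-after (suc k) g f u = splice-after k (λ i → g (suc i)) f u

  beforeOrAfter : ∀ k t → t < k ⊎ ∃ λ u → t ≡ k + u
  beforeOrAfter k t with t <? k
  ... | yes t<k = inj₁ t<k
  ... | no  t≮k with m≤n⇒∃[o]m+o≡n (≮⇒≥ t≮k)
  ...   | u , k+u≡t = inj₂ (u , sym k+u≡t)

  broadcasts-splice-before : ∀ k g f q t → t ≤ k →
                             broadcasts (splice k g f) q t ≡ broadcasts g q t
  broadcasts-splice-before k g f q t t≤k =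
    broadcasts-cong _ _ q t (λ i i<t → splice-before k g f i (≤-trans i<t t≤k))

  broadcasts-splice-after : ∀ k g f q u →
    broadcasts (splice k g f) q (k + u) ≡ broadcasts g q k + broadcasts f q u
  broadcasts-splice-after k g f q zero
    rewrite +-identityʳ k | +-identityʳ (broadcasts g q k) =
      broadcasts-splice-before k g f q k ≤-refl
  broadcasts-splice-after k g f q (suc u)
    rewrite +-suc k u | broadcasts-splice-after k g f q u | splice-after k g f u =
      +-assoc (broadcasts g q k) (broadcasts f q u) (broadcastBy (f u) q)

  splice-silent : ∀ k g f q → Silent g q → Silent f q → Silent (splice k g f) q
  splice-silent k g f q silent-g silent-f i with beforeOrAfter k i
  ... | inj₁ i<k rewrite splice-before k g f i i<k = silent-g i
  ... | inj₂ (u , refl) rewrite splice-after k g f u = silent-f u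

  solo : Fin n → ℕ → ℕ → Event n
  solo p k zero          = bcast p
  solo p k (suc zero)    = deliver p p k
  solo p k (suc (suc t)) = solo p (suc k) t

  solo-broadcast : ∀ p k j → solo p k (j + j) ≡ bcast p
  solo-broadcast p k zero    = refl
  solo-broadcast p k (suc j) rewrite +-suc j j = solo-broadcast p (suc k) j

  solo-delivery : ∀ p k j → solo p k (suc (j + j)) ≡ deliver p p (j + k)
  solo-delivery p k zero    = refl
  solo-delivery p k (suc j)
    rewrite +-suc j j | solo-delivery p (suc k) j | +-suc j k = refl

  solo-delivery⁻¹ : ∀ p k t r q i → solo p k t ≡ deliver r q i →
                    r ≡ p × q ≡ p × ∃ λ j → t ≡ suc (j + j) × i ≡ j + k
  solo-delivery⁻¹ p k zero r q i ()
  solo-delivery⁻¹ p k (suc zero) .p .p .k refl = refl , refl , 0 , refl , refl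
  solo-delivery⁻¹ p k (suc (suc t)) r q i e with solo-delivery⁻¹ p (suc k) t r q i e
  ... | refl , refl , j , refl , refl =
    refl , refl , suc j , cong (λ x → suc (suc x)) (sym (+-suc j j)) , +-suc j k

  solo-actor : ∀ p k t r → Acts (solo p k t) r → p ≡ r
  solo-actor p k zero          r acts = acts
  solo-actor p k (suc zero)    r acts = acts
  solo-actor p k (suc (suc t)) r acts = solo-actor p (suc k) t r acts

  solo-silent : ∀ p k q → ¬ q ≡ p → Silent (solo p k) q
  solo-silent p k q q≢p zero          = broadcastBy-other p q q≢p
  solo-silent p k q q≢p (suc zero)    = refl
  solo-silent p k q q≢p (suc (suc t)) = solo-silent p (suc k) q q≢p t

  broadcasts-solo-even : ∀ p k j → broadcasts (solo p k) p (j + j) ≡ j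
  broadcasts-solo-odd  : ∀ p k j → broadcasts (solo p k) p (suc (j + j)) ≡ suc j
  broadcasts-solo-odd p k j
    rewrite broadcasts-solo-even p k j | solo-broadcast p k j | broadcastBy-self p =
      +-comm j 1
  broadcasts-solo-even p k zero = refl
  broadcasts-solo-even p k (suc j)
    rewrite +-suc j j | broadcasts-solo-odd p k j | solo-delivery p k j =
      +-identityʳ (suc j)

  solo-delivery₀ : ∀ p j → solo p 0 (suc (j + j)) ≡ deliver p p j
  solo-delivery₀ p j = trans (solo-delivery p 0 j) (cong (deliver p p) (+-identityʳ j))

module Executions {n : ℕ} (A : Algorithm n) where
  open Schedules
  open Exec A

  roundCount-step : ∀ c e q → Config.rnd (step c e) q ≡ Config.rnd c q + broadcastBy e q
  roundCount-step c skip q = sym (+-identityʳ _)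
  roundCount-step c (bcast p) q with q ≟ p
  ... | yes refl = +-comm 1 _
  ... | no _     = sym (+-identityʳ _)
  roundCount-step c (deliver p r k) q with Config.sent c r k
  ... | nothing = sym (+-identityʳ _)
  ... | just _  = sym (+-identityʳ _)

  roundCount≡broadcasts : ∀ R q t → roundCount R q t ≡ broadcasts (Run.sched R) q t
  roundCount≡broadcasts R q zero    = refl
  roundCount≡broadcasts R q (suc t) =
    trans (roundCount-step (conf R t) (Run.sched R t) q)
          (cong (_+ broadcastBy (Run.sched R t) q) (roundCount≡broadcasts R q t))

  -- Indistinguishability: runs agreeing on the first t events have the same
  -- configuration at time t (crash times do not influence the execution).
  conf-agree : ∀ R R' t → (∀ i → i < t → Run.sched R i ≡ Run.sched R' i) →
               conf R t ≡ conf R' t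
  conf-agree R R' zero    same = refl
  conf-agree R R' (suc t) same =
    cong₂ step (conf-agree R R' t (λ i i<t → same i (m<n⇒m<1+n i<t))) (same t ≤-refl)

  silent-sentNothing : ∀ R q → Silent (Run.sched R) q → ∀ k t → ¬ SentBefore R q k t
  silent-sentNothing R q silent k t k<rounds =
    n≮0 (subst (k <_) (trans (roundCount≡broadcasts R q t)
                             (broadcasts-silent (Run.sched R) q silent t)) k<rounds)

module Impossibility (m : ℕ) (A : Algorithm (suc (suc m))) where
  open Schedules {n = suc (suc m)}
  open Exec A
  open Executions A

  p₀ p₁ : Fin (suc (suc m))
  p₀ = fz
  p₁ = fs fz

  p₀≢p₁ : ¬ p₀ ≡ p₁
  p₀≢p₁ ()

  soloCrash : Fin (suc (suc m)) → Maybe ℕ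
  soloCrash fz     = nothing
  soloCrash (fs _) = just 0

  soloRun : Run (suc (suc m))
  soloRun = record { crash = soloCrash ; sched = solo p₀ 0 }

  soloRun-correct : ∀ x → Correct soloRun x → x ≡ p₀
  soloRun-correct fz     _ = refl
  soloRun-correct (fs x) ()

  soloRun-round : ∀ k → roundCount soloRun p₀ (suc (k + k)) ≡ suc k
  soloRun-round k = trans (roundCount≡broadcasts soloRun p₀ (suc (k + k))) (broadcasts-solo-odd p₀ 0 k)

  soloRun-delivery⁻¹ : ∀ t p q k → Run.sched soloRun t ≡ deliver p q k →
                       p ≡ p₀ × q ≡ p₀ × t ≡ suc (k + k)
  soloRun-delivery⁻¹ t p q k e with solo-delivery⁻¹ p₀ 0 t p q k e
  ... | refl , refl , j , refl , refl rewrite +-identityʳ j = refl , refl , refl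

  soloRun-admissible : Admissible soloRun
  soloRun-admissible = record
    { someCorrect  = p₀ , refl
    ; onlyAlive    = λ t p acts → inj₁ (subst (Correct soloRun) (solo-actor p₀ 0 t p acts) refl)
    ; deliverSent  = sentBefore
    ; noDup        = λ t t' p q k e e' → trans (deliveryTime t e) (sym (deliveryTime t' e'))
    ; progress     = progress
    ; reliable     = reliable
    ; movingSource = λ k → p₀ , timely k
    }
    where
    deliveryTime : ∀ t {p q k} → Run.sched soloRun t ≡ deliver p q k → t ≡ suc (k + k)
    deliveryTime t {p} {q} {k} e = proj₂ (proj₂ (soloRun-delivery⁻¹ t p q k e))

    sentBefore : ∀ t p q k → Run.sched soloRun t ≡ deliver p q k → SentBefore soloRun q k t
    sentBefore t p q k e with soloRun-delivery⁻¹ t p q k e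
    ... | refl , refl , refl = ≤-reflexive (sym (soloRun-round k))

    progress : ∀ p → Correct soloRun p → ∀ T → ∃ λ t → T ≤ t × Run.sched soloRun t ≡ bcast p
    progress fz     _  T = T + T , m≤m+n T T , solo-broadcast p₀ 0 T
    progress (fs p) () T

    reliable : ∀ q k t → SentBefore soloRun q k t → ∀ p → Correct soloRun p →
               ∃ λ t' → Run.sched soloRun t' ≡ deliver p q k
    reliable fz     k t _    fz     _  = suc (k + k) , solo-delivery₀ p₀ k
    reliable (fs q) k t sent fz     _  =
      ⊥-elim (silent-sentNothing soloRun (fs q) (solo-silent p₀ 0 (fs q) (λ ())) k t sent)
    reliable q      k t _    (fs p) ()

    timely : ∀ k p → Correct soloRun p →
             ∃ λ t → Run.sched soloRun t ≡ deliver p p₀ k × roundCount soloRun p t ≡ suc k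
    timely k fz     _  = suc (k + k) , solo-delivery₀ p₀ k , soloRun-round k
    timely k (fs p) ()

  -- handoverRun a: p₀ runs alone for a rounds (times 0 … 2a-1) and crashes
  -- at time 2a; then p₁, the only correct process, receives p₀'s messages of
  -- rounds 0 … a-1 (times 2a … 3a-1) and afterwards runs alone.

  module Handover (a : ℕ) where

    handoverCrash : Fin (suc (suc m)) → Maybe ℕ
    handoverCrash fz           = just (a + a)
    handoverCrash (fs fz)      = nothing
    handoverCrash (fs (fs _))  = just 0

    relay : ℕ → Event (suc (suc m))
    relay j = deliver p₁ p₀ j

    afterCrash : ℕ → Event (suc (suc m))
    afterCrash = splice a relay (solo p₁ 0)

    handoverSched : ℕ → Event (suc (suc m))
    handoverSched = splice (a + a) (solo p₀ 0) afterCrash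

    handoverRun : Run (suc (suc m))
    handoverRun = record { crash = handoverCrash ; sched = handoverSched }

    handoverRun-correct : ∀ x → Correct handoverRun x → x ≡ p₁
    handoverRun-correct fz          ()
    handoverRun-correct (fs fz)     _ = refl
    handoverRun-correct (fs (fs x)) ()

    sched-solo₀ : ∀ t → t < a + a → handoverSched t ≡ solo p₀ 0 t
    sched-solo₀ t t<2a = splice-before (a + a) (solo p₀ 0) afterCrash t t<2a

    sched-relay : ∀ k → k < a → handoverSched (a + a + k) ≡ relay k
    sched-relay k k<a =
      trans (splice-after (a + a) (solo p₀ 0) afterCrash k) (splice-before a relay (solo p₁ 0) k k<a)

    sched-solo₁ : ∀ u → handoverSched (a + a + (a + u)) ≡ solo p₁ 0 u
    sched-solo₁ u =
      trans (splice-after (a + a) (solo p₀ 0) afterCrash (a + u)) (splice-after a relay (solo p₁ 0) u)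

    lateTime : ℕ → ℕ
    lateTime k = a + a + (a + suc (k + k))

    sched-lateDelivery : ∀ k → handoverSched (lateTime k) ≡ deliver p₁ p₁ k
    sched-lateDelivery k = trans (sched-solo₁ (suc (k + k))) (solo-delivery₀ p₁ k)

    broadcasts₀-early : ∀ t → t ≤ a + a → broadcasts handoverSched p₀ t ≡ broadcasts (solo p₀ 0) p₀ t
    broadcasts₀-early t t≤2a = broadcasts-splice-before (a + a) (solo p₀ 0) afterCrash p₀ t t≤2a

    p₀-silentAfterCrash : Silent afterCrash p₀
    p₀-silentAfterCrash = splice-silent a relay (solo p₁ 0) p₀ (λ _ → refl) (solo-silent p₁ 0 p₀ p₀≢p₁)

    broadcasts₀-late : ∀ u → broadcasts handoverSched p₀ (a + a + u) ≡ a
    broadcasts₀-late u = trans (broadcasts-splice-after (a + a) (solo p₀ 0) afterCrash p₀ u)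
      (trans (cong₂ _+_ (broadcasts-solo-even p₀ 0 a) (broadcasts-silent afterCrash p₀ p₀-silentAfterCrash u))
             (+-identityʳ a))

    broadcasts₀-bounded : ∀ t → broadcasts handoverSched p₀ t ≤ a
    broadcasts₀-bounded t with beforeOrAfter (a + a) t
    ... | inj₁ t<2a rewrite broadcasts₀-early t (<⇒≤ t<2a) =
      subst (broadcasts (solo p₀ 0) p₀ t ≤_) (broadcasts-solo-even p₀ 0 a)
            (broadcasts-mono (solo p₀ 0) p₀ (<⇒≤ t<2a))
    ... | inj₂ (u , refl) = ≤-reflexive (broadcasts₀-late u)

    broadcasts₁-late : ∀ u → broadcasts handoverSched p₁ (a + a + (a + u)) ≡ broadcasts (solo p₁ 0) p₁ u
    broadcasts₁-late u = trans (broadcasts-splice-after (a + a) (solo p₀ 0) afterCrash p₁ (a + u))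
      (cong₂ _+_ (broadcasts-silent (solo p₀ 0) p₁ (solo-silent p₀ 0 p₁ (λ ())) (a + a))
                 (trans (broadcasts-splice-after a relay (solo p₁ 0) p₁ u)
                        (cong (_+ broadcasts (solo p₁ 0) p₁ u) (broadcasts-silent relay p₁ (λ _ → refl) a))))

    round₁-late : ∀ k → roundCount handoverRun p₁ (lateTime k) ≡ suc k
    round₁-late k = trans (roundCount≡broadcasts handoverRun p₁ (lateTime k))
                          (trans (broadcasts₁-late (suc (k + k))) (broadcasts-solo-odd p₁ 0 k))

    others-silent : ∀ q → Silent handoverSched (fs (fs q))
    others-silent q = splice-silent (a + a) (solo p₀ 0) afterCrash (fs (fs q)) (solo-silent p₀ 0 (fs (fs q)) (λ ()))
      (splice-silent a relay (solo p₁ 0) (fs (fs q)) (λ _ → refl) (solo-silent p₁ 0 (fs (fs q)) (λ ())))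

    data Delivery (t : ℕ) : Fin (suc (suc m)) → Fin (suc (suc m)) → ℕ → Set where
      early   : ∀ k → t ≡ suc (k + k) → t < a + a → Delivery t p₀ p₀ k
      relayed : ∀ k → k < a → t ≡ a + a + k → Delivery t p₁ p₀ k
      late    : ∀ k → t ≡ lateTime k → Delivery t p₁ p₁ k

    delivery⁻¹ : ∀ t p q k → handoverSched t ≡ deliver p q k → Delivery t p q k
    delivery⁻¹ t p q k e with beforeOrAfter (a + a) t
    ... | inj₁ t<2a with solo-delivery⁻¹ p₀ 0 t p q k (trans (sym (sched-solo₀ t t<2a)) e)
    ...   | refl , refl , j , t≡ , refl rewrite +-identityʳ j = early j t≡ t<2a
    delivery⁻¹ t p q k e | inj₂ (u , refl) with beforeOrAfter a u
    ... | inj₁ u<a with trans (sym (sched-relay u u<a)) e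
    ...   | refl = relayed u u<a refl
    delivery⁻¹ t p q k e | inj₂ (u , refl) | inj₂ (v , refl)
      with solo-delivery⁻¹ p₁ 0 v p q k (trans (sym (sched-solo₁ v)) e)
    ... | refl , refl , j , refl , refl rewrite +-identityʳ j = late j refl

    deliveryTime : Fin (suc (suc m)) → Fin (suc (suc m)) → ℕ → ℕ
    deliveryTime fz     _      k = suc (k + k)
    deliveryTime (fs _) fz     k = a + a + k
    deliveryTime (fs _) (fs _) k = lateTime k

    delivery-time : ∀ {t p q k} → Delivery t p q k → t ≡ deliveryTime p q k
    delivery-time (early k t≡ _)   = t≡
    delivery-time (relayed k _ t≡) = t≡
    delivery-time (late k t≡)      = t≡

    handoverRun-admissible : Admissible handoverRun
    handoverRun-admissible = record
      { someCorrect  = p₁ , refl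
      ; onlyAlive    = onlyAlive
      ; deliverSent  = sentBefore
      ; noDup        = λ t t' p q k e e' →
          trans (delivery-time (delivery⁻¹ t p q k e)) (sym (delivery-time (delivery⁻¹ t' p q k e')))
      ; progress     = progress
      ; reliable     = reliable
      ; movingSource = λ k → p₁ , timely k
      }
      where
      onlyAlive : ∀ t p → Acts (handoverSched t) p → Alive handoverRun p t
      onlyAlive t p acts with beforeOrAfter (a + a) t
      ... | inj₁ t<2a with solo-actor p₀ 0 t p (subst (λ e → Acts e p) (sched-solo₀ t t<2a) acts)
      ...   | refl = inj₂ (a + a , refl , t<2a)
      onlyAlive t p acts | inj₂ (u , refl) with beforeOrAfter a u
      ... | inj₁ u<a with subst (λ e → Acts e p) (sched-relay u u<a) acts
      ...   | refl = inj₁ refl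
      onlyAlive t p acts | inj₂ (u , refl) | inj₂ (v , refl)
        with solo-actor p₁ 0 v p (subst (λ e → Acts e p) (sched-solo₁ v) acts)
      ... | refl = inj₁ refl

      sentBefore : ∀ t p q k → handoverSched t ≡ deliver p q k → SentBefore handoverRun q k t
      sentBefore t p q k e with delivery⁻¹ t p q k e
      ... | early k refl t<2a = ≤-reflexive (sym (trans (roundCount≡broadcasts handoverRun p₀ (suc (k + k)))
              (trans (broadcasts₀-early (suc (k + k)) (<⇒≤ t<2a)) (broadcasts-solo-odd p₀ 0 k))))
      ... | relayed k k<a refl =
              subst (k <_) (sym (trans (roundCount≡broadcasts handoverRun p₀ (a + a + k)) (broadcasts₀-late k))) k<a
      ... | late k refl = ≤-reflexive (sym (round₁-late k))

      progress : ∀ p → Correct handoverRun p → ∀ T → ∃ λ t → T ≤ t × handoverSched t ≡ bcast p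
      progress fz          () T
      progress (fs fz)     _  T = a + a + (a + (T + T)) ,
        ≤-trans (m≤m+n T T) (≤-trans (m≤n+m (T + T) a) (m≤n+m (a + (T + T)) (a + a))) ,
        trans (sched-solo₁ (T + T)) (solo-broadcast p₁ 0 T)
      progress (fs (fs p)) () T

      reliable : ∀ q k t → SentBefore handoverRun q k t → ∀ p → Correct handoverRun p →
                 ∃ λ t' → handoverSched t' ≡ deliver p q k
      reliable q           k t _    fz          ()
      reliable q           k t _    (fs (fs p)) ()
      reliable fz          k t sent (fs fz)     _  = a + a + k , sched-relay k
        (≤-trans sent (≤-trans (≤-reflexive (roundCount≡broadcasts handoverRun p₀ t)) (broadcasts₀-bounded t)))
      reliable (fs fz)     k t _    (fs fz)     _  = lateTime k , sched-lateDelivery k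
      reliable (fs (fs q)) k t sent (fs fz)     _  =
        ⊥-elim (silent-sentNothing handoverRun (fs (fs q)) (others-silent q) k t sent)

      timely : ∀ k p → Correct handoverRun p →
               ∃ λ t → handoverSched t ≡ deliver p p₁ k × roundCount handoverRun p t ≡ suc k
      timely k fz          ()
      timely k (fs fz)     _  = lateTime k , sched-lateDelivery k , round₁-late k
      timely k (fs (fs p)) ()

    p₀-indistinguishable : outAt handoverRun p₀ (a + a) ≡ outAt soloRun p₀ (a + a)
    p₀-indistinguishable =
      cong (λ c → Algorithm.output A (Config.st c p₀)) (conf-agree handoverRun soloRun (a + a) sched-solo₀)

  open Handover using (handoverRun; handoverRun-correct; handoverRun-admissible; p₀-indistinguishable)

  noEmulation : ¬ EmulatesΣ-MS A
  noEmulation emulates =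
    let open SigmaOutputs
        T , soloComplete = completeness (emulates soloRun soloRun-admissible)
        handover = emulates (handoverRun T) (handoverRun-admissible T)
        T' , handoverComplete = completeness handover
        x , x∈out₀ , x∈out₁ = intersection handover p₀ p₁ (T + T) T'
        -- In soloRun p₀'s output at time 2T contains only p₀ ...
        x≡p₀ = soloRun-correct x (soloComplete p₀ refl (T + T) (m≤m+n T T) x
                                   (subst (x ∈_) (p₀-indistinguishable T) x∈out₀))
        -- ... while in handoverRun T p₁ eventually outputs only p₁.
        x≡p₁ = handoverRun-correct T x (handoverComplete p₁ refl T' ≤-refl x x∈out₁)
    in p₀≢p₁ (trans (sym x≡p₀) x≡p₁)

mainTheorem6 : (n : ℕ) → 2 ≤ n → (A : Algorithm n) → ¬ EmulatesΣ-MS A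
mainTheorem6 (suc (suc m)) (s≤s (s≤s z≤n)) A = Impossibility.noEmulation m A
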